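{- Let $m$ be a positive integer and let $A,B$ be finite multisets of elements of $\{1,\dots,m\}$. If $\sum A\ge m^2$ and $\sum B\ge m^2$, then the pair $(A,B)$ is reducible.
   Context: For a finite multiset $A$, $\sum A$ denotes the sum of its elements (with multiplicity). A pair $(A,B)$ of multisets of elements of $\{1,\dots,m\}$ is called reducible if there exist a nonempty sub-multiset $A'\subseteq A$ and a nonempty sub-multiset $B'\subseteq B$ with $\sum A'=\sum B'$; otherwise it is called irreducible. -}

module Defs where

open import Data.Nat using (ℕ; _≤_; _*_)
open import Data.List using (List; [])
open import Data.Nat.ListAction using (sum)
open import Data.List.Relation.Unary.All using (All)
open import Data.List.Relation.Binary.Sublist.Propositional using (_⊆_)
open import Data.Product using (Σ; _×_; ∃; ∃-syntax)
open import Relation.Binary.PropositionalEquality using (_≡_; _≢_)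
open import Relation.Nullary using (¬_)

-- A finite multiset is represented by a list (order irrelevant).
-- A sub-multiset of A corresponds to a sublist (subsequence) of A.

InRange : ℕ → ℕ → Set
InRange m x = 1 ≤ x × x ≤ m

MultisetOver : ℕ → List ℕ → Set
MultisetOver m A = All (InRange m) A

Reducible : List ℕ → List ℕ → Set
Reducible A B =
  ∃[ A' ] ∃[ B' ] (A' ⊆ A × B' ⊆ B × A' ≢ [] × B' ≢ [] × sum A' ≡ sum B')

Irreducible : List ℕ → List ℕ → Set
Irreducible A B = ¬ Reducible A B

-- Let a₀ ≤ a₁ ≤ … and b₀ ≤ b₁ ≤ … be the prefix sums of A and B.  For
-- each i ≤ m we have aᵢ ≤ i m ≤ m² ≤ ΣB, so there is a first index jᵢ with
-- aᵢ ≤ b_{jᵢ}, and the overshoot b_{jᵢ} − aᵢ is less than m because the step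
-- into b_{jᵢ} is at most m.  Among the m + 1 overshoots two agree, say for
-- i < i'; then A[i, i') and B[j_i, j_i') have the same sum, which is positive
-- since the entries of A are positive.
module Submission where

open import Defs
open import Data.Nat
  using (ℕ; zero; suc; _+_; _*_; _∸_; _≤_; _<_; z≤n; s≤s; s≤s⁻¹; NonZero; >-nonZero)
open import Data.Nat.Properties
open import Data.Nat.ListAction using (sum)
open import Data.List using (List; []; _∷_; take; drop; length)
open import Data.List.Properties using (take-[]; take-all)
open import Data.List.Relation.Unary.All using (All; []; _∷_)
import Data.List.Relation.Unary.All as All
open import Data.List.Relation.Binary.Sublist.Propositional using (_⊆_; ⊆-trans)
open import Data.List.Relation.Binary.Sublist.Propositional.Properties using (take-⊆; drop-⊆)
open import Data.Fin using (Fin; toℕ; fromℕ<) renaming (_<_ to _<ᶠ_)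
open import Data.Fin.Properties using (pigeonhole; toℕ<n; toℕ-fromℕ<)
open import Data.Product using (_×_; _,_; proj₁; proj₂; ∃₂)
open import Data.Sum using (inj₁; inj₂)
open import Relation.Binary.PropositionalEquality

pigeonhole-≤ : ∀ n (f : ℕ → ℕ) → (∀ i → f i < n) →
  ∃₂ λ i i' → i < i' × i' ≤ n × f i ≡ f i'
pigeonhole-≤ n f f<n = fromFin (pigeonhole (n<1+n n) g)
  where
  g : Fin (suc n) → Fin n
  g u = fromℕ< (f<n (toℕ u))
  fromFin : (∃₂ λ u v → u <ᶠ v × g u ≡ g v) → ∃₂ λ i i' → i < i' × i' ≤ n × f i ≡ f i'
  fromFin (u , v , u<v , gu≡gv) =
    toℕ u , toℕ v , u<v , s≤s⁻¹ (toℕ<n v) ,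
    trans (sym (toℕ-fromℕ< _)) (trans (cong toℕ gu≡gv) (toℕ-fromℕ< _))

m∸n≡o∸p⇒n+o≡p+m : ∀ {m n o p} → n ≤ m → p ≤ o → m ∸ n ≡ o ∸ p → n + o ≡ p + m
m∸n≡o∸p⇒n+o≡p+m {m} {n} {o} {p} n≤m p≤o eq = begin
  n + o               ≡⟨ cong (n +_) (sym (m+[n∸m]≡n p≤o)) ⟩
  n + (p + (o ∸ p))   ≡⟨ cong (λ d → n + (p + d)) (sym eq) ⟩
  n + (p + (m ∸ n))   ≡⟨ +-comm n _ ⟩
  (p + (m ∸ n)) + n   ≡⟨ +-assoc p _ n ⟩
  p + ((m ∸ n) + n)   ≡⟨ cong (p +_) (m∸n+n≡m n≤m) ⟩
  p + m               ∎
  where open ≡-Reasoning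

prefixSum : ℕ → List ℕ → ℕ
prefixSum i xs = sum (take i xs)

segment : ℕ → ℕ → List ℕ → List ℕ
segment i i' xs = take (i' ∸ i) (drop i xs)

segment-⊆ : ∀ i i' (xs : List ℕ) → segment i i' xs ⊆ xs
segment-⊆ i i' xs = ⊆-trans (take-⊆ (i' ∸ i) (drop i xs)) (drop-⊆ i xs)

prefixSum-segment : ∀ {i i'} (xs : List ℕ) → i ≤ i' →
  prefixSum i' xs ≡ prefixSum i xs + sum (segment i i' xs)
prefixSum-segment xs       z≤n                     = refl
prefixSum-segment []       (s≤s {m = i} {n = i'} _) = cong sum (sym (take-[] (i' ∸ i)))
prefixSum-segment (x ∷ xs) (s≤s i≤i')              =
  trans (cong (x +_) (prefixSum-segment xs i≤i')) (sym (+-assoc x _ _))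

prefixSum-length : (xs : List ℕ) → prefixSum (length xs) xs ≡ sum xs
prefixSum-length xs = cong sum (take-all (length xs) xs ≤-refl)

prefixSum-≤ : ∀ {m} {xs : List ℕ} → All (_≤ m) xs → ∀ i → prefixSum i xs ≤ i * m
prefixSum-≤ _            zero    = z≤n
prefixSum-≤ []           (suc i) = z≤n
prefixSum-≤ (x≤m ∷ xs≤m) (suc i) = +-mono-≤ x≤m (prefixSum-≤ xs≤m i)

prefixSum-< : ∀ {xs : List ℕ} {i i'} → All (1 ≤_) xs → i < i' → i' ≤ length xs →
  prefixSum i xs < prefixSum i' xs
prefixSum-< {x ∷ _} (1≤x ∷ _)  (s≤s z≤n)        _              = ≤-trans 1≤x (m≤m+n x _)
prefixSum-< {x ∷ _} (_ ∷ xs≥1) (s≤s (s≤s i<i')) (s≤s i'≤|xs|) =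
  +-monoʳ-< x (prefixSum-< xs≥1 (s≤s i<i') i'≤|xs|)

prefixSums⇒reducible : ∀ {A B : List ℕ} {i i' j j'} → i ≤ i' → j ≤ j' →
  prefixSum i A < prefixSum i' A →
  prefixSum i A + prefixSum j' B ≡ prefixSum i' A + prefixSum j B →
  Reducible A B
prefixSums⇒reducible {A} {B} {i} {i'} {j} {j'} i≤i' j≤j' a<a' eq =
  segment i i' A , segment j j' B , segment-⊆ i i' A , segment-⊆ j j' B ,
  nonempty ΣA'>0 , nonempty (subst (0 <_) ΣA'≡ΣB' ΣA'>0) , ΣA'≡ΣB'
  where
  a b ΣA' ΣB' : ℕ
  a = prefixSum i A
  b = prefixSum j B
  ΣA' = sum (segment i i' A)
  ΣB' = sum (segment j j' B)

  nonempty : ∀ {xs} → 0 < sum xs → xs ≢ []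
  nonempty () refl

  ΣA'>0 : 0 < ΣA'
  ΣA'>0 = +-cancelˡ-< a 0 ΣA' (subst₂ _<_ (sym (+-identityʳ a)) (prefixSum-segment A i≤i') a<a')

  ΣA'≡ΣB' : ΣA' ≡ ΣB'
  ΣA'≡ΣB' = sym (+-cancelˡ-≡ b _ _ (+-cancelˡ-≡ a _ _ (begin
    a + (b + ΣB')        ≡⟨ cong (a +_) (sym (prefixSum-segment B j≤j')) ⟩
    a + prefixSum j' B   ≡⟨ eq ⟩
    prefixSum i' A + b   ≡⟨ cong (_+ b) (prefixSum-segment A i≤i') ⟩
    (a + ΣA') + b        ≡⟨ +-assoc a ΣA' b ⟩
    a + (ΣA' + b)        ≡⟨ cong (a +_) (+-comm ΣA' b) ⟩
    a + (b + ΣA')        ∎)))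
    where open ≡-Reasoning

-- The least j with x ≤ prefixSum j ys, or length ys if there is none.
reach : ℕ → List ℕ → ℕ
reach zero      _        = 0
reach (suc _)   []       = 0
reach x@(suc _) (y ∷ ys) = suc (reach (x ∸ y) ys)

reach-mono : ∀ {x x'} (ys : List ℕ) → x ≤ x' → reach x ys ≤ reach x' ys
reach-mono _        z≤n              = z≤n
reach-mono []       (s≤s _)          = ≤-refl
reach-mono (y ∷ ys) x≤x'@(s≤s _) = s≤s (reach-mono ys (∸-monoˡ-≤ y x≤x'))

reach-≥ : ∀ {x} (ys : List ℕ) → x ≤ sum ys → x ≤ prefixSum (reach x ys) ys
reach-≥ {zero}  _        _      = z≤n
reach-≥ {suc x} (y ∷ ys) x≤Σys =
  ≤-trans (m≤n+m∸n (suc x) y) (+-monoʳ-≤ y (reach-≥ ys (m≤n+o⇒m∸n≤o (suc x) y x≤Σys)))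

reach-< : ∀ {m x} {ys : List ℕ} → 0 < m → All (_≤ m) ys → prefixSum (reach x ys) ys < x + m
reach-< {x = zero}       0<m _ = 0<m
reach-< {x = suc x} {[]} _   _ = s≤s z≤n
reach-< {m} {suc x} {y ∷ ys} 0<m (y≤m ∷ ys≤m) with ≤-total y (suc x)
... | inj₁ y≤1+x = begin-strict
  y + prefixSum (reach (suc x ∸ y) ys) ys   <⟨ +-monoʳ-< y (reach-< 0<m ys≤m) ⟩
  y + (suc x ∸ y + m)                        ≡⟨ sym (+-assoc y _ m) ⟩
  y + (suc x ∸ y) + m                        ≡⟨ cong (_+ m) (m+[n∸m]≡n y≤1+x) ⟩
  suc x + m                                  ∎
  where open ≤-Reasoning
... | inj₂ 1+x≤y rewrite m≤n⇒m∸n≡0 1+x≤y = begin-strict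
  y + 0       ≡⟨ +-identityʳ y ⟩
  y           ≤⟨ y≤m ⟩
  m           <⟨ m<n+m m (s≤s z≤n) ⟩
  suc x + m   ∎
  where open ≤-Reasoning

lemma1 : (m : ℕ) → 1 ≤ m → (A B : List ℕ) → MultisetOver m A → MultisetOver m B →
    m * m ≤ sum A → m * m ≤ sum B → Reducible A B
lemma1 m 0<m A B A∈ B∈ m²≤ΣA m²≤ΣB = close (pigeonhole-≤ m overshoot overshoot<m)
  where
  instance
    m≢0 : NonZero m
    m≢0 = >-nonZero 0<m

  A≥1 : All (1 ≤_) A
  A≥1 = All.map proj₁ A∈

  A≤m : All (_≤ m) A
  A≤m = All.map proj₂ A∈

  B≤m : All (_≤ m) B
  B≤m = All.map proj₂ B∈

  a : ℕ → ℕ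
  a i = prefixSum i A

  b : ℕ → ℕ
  b i = prefixSum (reach (a i) B) B

  overshoot : ℕ → ℕ
  overshoot i = b i ∸ a i

  overshoot<m : ∀ i → overshoot i < m
  overshoot<m i = m<n+o⇒m∸n<o (b i) (a i) (reach-< 0<m B≤m)

  a≤b : ∀ {i} → i ≤ m → a i ≤ b i
  a≤b {i} i≤m = reach-≥ B (≤-trans (prefixSum-≤ A≤m i) (≤-trans (*-monoˡ-≤ m i≤m) m²≤ΣB))

  m≤|A| : m ≤ length A
  m≤|A| = *-cancelʳ-≤ m (length A) m (begin
    m * m                    ≤⟨ m²≤ΣA ⟩
    sum A                    ≡⟨ sym (prefixSum-length A) ⟩
    prefixSum (length A) A   ≤⟨ prefixSum-≤ A≤m (length A) ⟩
    length A * m             ∎)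
    where open ≤-Reasoning

  close : (∃₂ λ i i' → i < i' × i' ≤ m × overshoot i ≡ overshoot i') → Reducible A B
  close (i , i' , i<i' , i'≤m , d≡d') =
    prefixSums⇒reducible (<⇒≤ i<i') (reach-mono B (<⇒≤ a<a')) a<a'
      (m∸n≡o∸p⇒n+o≡p+m (a≤b (≤-trans (<⇒≤ i<i') i'≤m)) (a≤b i'≤m) d≡d')
    where
    a<a' : a i < a i'
    a<a' = prefixSum-< A≥1 i<i' (≤-trans i'≤m m≤|A|)
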